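{- Let $n_1,n_2$ be positive integers. If, for $i=1,2$, there exists a balancedly splittable Hadamard matrix of order $n_i$ with parameters $\left(n_i,\frac{n_i+\sqrt{n_i}}{2},\frac{\sqrt{n_i}}{2},-\frac{\sqrt{n_i}}{2}\right)$, then there exists a balancedly splittable Hadamard matrix of order $n_1n_2$ with parameters $\left(n_1n_2,\frac{n_1n_2+\sqrt{n_1n_2}}{2},\frac{\sqrt{n_1n_2}}{2},-\frac{\sqrt{n_1n_2}}{2}\right)$.
   Context: A Hadamard matrix of order $n$ is an $n\times n$ $\{1,-1\}$-matrix $H$ with $HH^\top=nI_n$; $J_n$ is the all-ones matrix. $H$ is balancedly splittable with parameters $(n,\ell,a,b)$ if, after permuting its rows, $H=\begin{pmatrix}H_1\\H_2\end{pmatrix}$ with $H_1$ an $\ell\times n$ matrix such that $H_1^\top H_1=\ell I_n+aA+b(J_n-A-I_n)$ for a symmetric $(0,1)$-matrix $A$ with zero diagonal. -}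

module Defs where

open import Data.Nat as ℕ using (ℕ; zero; suc; _≤_)
open import Data.Integer as ℤ using (ℤ; +_; -_; _+_; _-_; _*_)
open import Data.Fin using (Fin; zero; suc; inject≤)
open import Data.Fin.Permutation using (Permutation′; _⟨$⟩ʳ_)
open import Data.Product using (Σ; ∃; _×_; _,_)
open import Data.Sum using (_⊎_)
open import Relation.Binary.PropositionalEquality using (_≡_)

Mat : ℕ → ℕ → Set
Mat m n = Fin m → Fin n → ℤ

Σℤ : (n : ℕ) → (Fin n → ℤ) → ℤ
Σℤ zero    f = + 0
Σℤ (suc n) f = f zero + Σℤ n (λ k → f (suc k))

δ : ∀ {n} → Fin n → Fin n → ℤ
δ zero    zero    = + 1
δ zero    (suc j) = + 0
δ (suc i) zero    = + 0
δ (suc i) (suc j) = δ i j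

gramT : ∀ {m n} → Mat m n → Fin n → Fin n → ℤ
gramT {m} M i j = Σℤ m (λ k → M k i * M k j)

gram : ∀ {m n} → Mat m n → Fin m → Fin m → ℤ
gram {n = n} M i j = Σℤ n (λ k → M i k * M j k)

IsHadamard : (n : ℕ) → Mat n n → Set
IsHadamard n H =
  (∀ i j → (H i j ≡ + 1) ⊎ (H i j ≡ - + 1)) ×
  (∀ i j → gram H i j ≡ + n * δ i j)

IsAdjacency : (n : ℕ) → Mat n n → Set
IsAdjacency n A =
  (∀ i j → (A i j ≡ + 0) ⊎ (A i j ≡ + 1)) ×
  (∀ i j → A i j ≡ A j i) ×
  (∀ i → A i i ≡ + 0)

-- The parameters a, b are half-integers in the paper, so they are passed
-- doubled (a₂ = 2a, b₂ = 2b) and the defining identity is multiplied by 2: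
--   2 H₁ᵀH₁ = 2ℓ I + a₂ A + b₂ (J − A − I).
-- "after permuting its rows, H = (H₁ ; H₂) with H₁ of size ℓ × n":
-- H₁ consists of the first ℓ rows of the row-permuted matrix.
BalancedlySplittable₂ : (n : ℕ) → Mat n n → (ℓ : ℕ) → (a₂ b₂ : ℤ) → Set
BalancedlySplittable₂ n H ℓ a₂ b₂ =
  Σ (ℓ ≤ n) λ ℓ≤n → Σ (Permutation′ n) λ π → Σ (Mat n n) λ A →
    IsAdjacency n A ×
    (∀ i j →
      + 2 * gramT (λ (r : Fin ℓ) c → H (π ⟨$⟩ʳ inject≤ r ℓ≤n) c) i j
        ≡ + (2 ℕ.* ℓ) * δ i j + a₂ * A i j
          + b₂ * (+ 1 - A i j - δ i j))

-- Here s plays the role of √n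
-- (s * s ≡ n, s ≥ 0), and ℓ = (n+√n)/2 is the natural number with 2ℓ = n + s.
HasBSHadamardSqrtParams : ℕ → Set
HasBSHadamardSqrtParams n =
  Σ ℕ λ s → (s ℕ.* s ≡ n) ×
  Σ ℕ λ ℓ → (2 ℕ.* ℓ ≡ n ℕ.+ s) ×
  Σ (Mat n n) λ H → IsHadamard n H ×
    BalancedlySplittable₂ n H ℓ (+ s) (- (+ s))

module Submission where

-- Write s = √n.  Marking the ℓ rows of H₁ with +1 and the other rows of H with
-- −1 gives a diagonal ±1 matrix Y, and (using HᵀH = nI) the splitting identity
-- 2H₁ᵀH₁ = (n+s)I + sA − s(J−A−I) is equivalent to the signed identity
--   HᵀYH = s·S,   S = 2(A+I) − J,   together with  trace Y = 2ℓ − n = s.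
-- S is a symmetric ±1 matrix with unit diagonal.  In this signed form the
-- Kronecker product works factor by factor:
--   (H₁⊗H₂)ᵀ(Y₁⊗Y₂)(H₁⊗H₂) = s₁s₂·(S₁⊗S₂)   and   trace(Y₁⊗Y₂) = s₁s₂.

open import Defs
open import Data.Nat using (ℕ; _*_; _<_)
open import Data.Nat as ℕ using (zero; suc)
import Data.Nat.Properties as ℕP
open import Data.Integer as ℤ
  using (ℤ; +_; -_; 0ℤ; _+_; _-_; _≤_; +≤+; +[1+_]; -[1+_])
  renaming (_*_ to infixl 7 _·_)
import Data.Integer.Properties as ℤP
open import Algebra.Bundles using (AbelianGroup)
open import Algebra.Properties.Group (AbelianGroup.group ℤP.+-0-abelianGroup)
  using () renaming (∙-cancelʳ to +-cancelʳ)
open import Algebra.Properties.CommutativeSemigroup ℤP.+-commutativeSemigroup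
  using () renaming (interchange to +-interchange)
open import Algebra.Properties.CommutativeSemigroup ℤP.*-commutativeSemigroup
  using () renaming (interchange to ·-interchange)
open import Data.Integer.Tactic.RingSolver using (solve-∀)
open import Data.Fin as Fin
  using (Fin; zero; suc; toℕ; inject≤; combine; remQuot; _↑ˡ_; _↑ʳ_; punchIn)
import Data.Fin.Properties as FinP
open import Data.Fin.Permutation as Perm using (Permutation′; _⟨$⟩ʳ_; _⟨$⟩ˡ_)
open import Data.Bool using (Bool; true; false; not; _xor_)
open import Data.Product using (_,_; proj₁; proj₂)
open import Data.Sum using (_⊎_; inj₁; inj₂)
open import Relation.Nullary using (yes; no)
open import Relation.Binary.PropositionalEquality
  using (_≡_; _≢_; refl; sym; trans; cong; cong₂; subst; subst₂; module ≡-Reasoning)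
open import Data.Empty using (⊥-elim)
open import Function using (_∘_)
import Algebra.Properties.CommutativeMonoid.Sum as CommutativeMonoidSum

∑ : (n : ℕ) → (Fin n → ℤ) → ℤ
∑ = Σℤ

syntax ∑ n (λ k → e) = ∑[ k < n ] e

∑-cong : ∀ n {f g : Fin n → ℤ} → (∀ k → f k ≡ g k) → ∑ n f ≡ ∑ n g
∑-cong zero    f≗g = refl
∑-cong (suc n) f≗g = cong₂ _+_ (f≗g zero) (∑-cong n (f≗g ∘ suc))

∑-+ : ∀ n (f g : Fin n → ℤ) → ∑[ k < n ] (f k + g k) ≡ ∑ n f + ∑ n g
∑-+ zero    f g = refl
∑-+ (suc n) f g = trans (cong (λ t → (f zero + g zero) + t) (∑-+ n (f ∘ suc) (g ∘ suc)))
                        (+-interchange (f zero) (g zero) _ _)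

∑-*ˡ : ∀ n c (f : Fin n → ℤ) → ∑[ k < n ] (c · f k) ≡ c · ∑ n f
∑-*ˡ zero    c f = sym (ℤP.*-zeroʳ c)
∑-*ˡ (suc n) c f = trans (cong (λ t → c · f zero + t) (∑-*ˡ n c (f ∘ suc)))
                         (sym (ℤP.*-distribˡ-+ c _ _))

∑-const : ∀ n c → ∑[ k < n ] c ≡ + n · c
∑-const zero    c = sym (ℤP.*-zeroˡ c)
∑-const (suc n) c = trans (cong (λ t → c + t) (∑-const n c)) (sym (ℤP.suc-* (+ n) c))

∑-zero : ∀ n → ∑[ k < n ] 0ℤ ≡ 0ℤ
∑-zero n = trans (∑-const n 0ℤ) (ℤP.*-zeroʳ (+ n))

∑-swap : ∀ m n (f : Fin m → Fin n → ℤ) →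
  ∑[ a < m ] ∑[ b < n ] f a b ≡ ∑[ b < n ] ∑[ a < m ] f a b
∑-swap zero    n f = sym (∑-zero n)
∑-swap (suc m) n f = trans (cong (λ t → ∑ n (f zero) + t) (∑-swap m n (f ∘ suc)))
                           (sym (∑-+ n (f zero) (λ b → ∑[ a < m ] f (suc a) b)))

∑-swap-pairs : ∀ m n (f : Fin m → Fin m → Fin n → Fin n → ℤ) →
  ∑[ a < m ] ∑[ b < m ] ∑[ c < n ] ∑[ d < n ] f a b c d ≡
  ∑[ c < n ] ∑[ d < n ] ∑[ a < m ] ∑[ b < m ] f a b c d
∑-swap-pairs m n f = begin
  ∑[ a < m ] ∑[ b < m ] ∑[ c < n ] ∑[ d < n ] f a b c d
    ≡⟨ ∑-cong m (λ a → ∑-swap m n (λ b c → ∑[ d < n ] f a b c d)) ⟩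
  ∑[ a < m ] ∑[ c < n ] ∑[ b < m ] ∑[ d < n ] f a b c d
    ≡⟨ ∑-cong m (λ a → ∑-cong n (λ c → ∑-swap m n (λ b d → f a b c d))) ⟩
  ∑[ a < m ] ∑[ c < n ] ∑[ d < n ] ∑[ b < m ] f a b c d
    ≡⟨ ∑-swap m n (λ a c → ∑[ d < n ] ∑[ b < m ] f a b c d) ⟩
  ∑[ c < n ] ∑[ a < m ] ∑[ d < n ] ∑[ b < m ] f a b c d
    ≡⟨ ∑-cong n (λ c → ∑-swap m n (λ a d → ∑[ b < m ] f a b c d)) ⟩
  ∑[ c < n ] ∑[ d < n ] ∑[ a < m ] ∑[ b < m ] f a b c d ∎
  where open ≡-Reasoning

∑-product : ∀ m n (f : Fin m → ℤ) (g : Fin n → ℤ) →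
  ∑ m f · ∑ n g ≡ ∑[ a < m ] ∑[ b < n ] (f a · g b)
∑-product m n f g = begin
  ∑ m f · ∑ n g                ≡⟨ ℤP.*-comm (∑ m f) _ ⟩
  ∑ n g · ∑ m f                ≡⟨ ∑-*ˡ m (∑ n g) f ⟨
  ∑[ a < m ] (∑ n g · f a)     ≡⟨ ∑-cong m (λ a → ℤP.*-comm (∑ n g) (f a)) ⟩
  ∑[ a < m ] (f a · ∑ n g)     ≡⟨ ∑-cong m (λ a → ∑-*ˡ n (f a) g) ⟨
  ∑[ a < m ] ∑[ b < n ] (f a · g b) ∎
  where open ≡-Reasoning

∑-split : ∀ m n (f : Fin (m ℕ.+ n) → ℤ) →
  ∑ (m ℕ.+ n) f ≡ ∑[ a < m ] f (a ↑ˡ n) + ∑[ b < n ] f (m ↑ʳ b)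
∑-split zero    n f = sym (ℤP.+-identityˡ _)
∑-split (suc m) n f = trans (cong (λ t → f zero + t) (∑-split m n (f ∘ suc)))
                            (sym (ℤP.+-assoc (f zero) _ _))

∑-combine : ∀ m n (f : Fin (m * n) → ℤ) →
  ∑ (m * n) f ≡ ∑[ a < m ] ∑[ b < n ] f (combine a b)
∑-combine zero    n f = refl
∑-combine (suc m) n f = trans (∑-split n (m * n) f)
  (cong (λ t → ∑[ b < n ] f (b ↑ˡ (m * n)) + t) (∑-combine m n (λ c → f (n ↑ʳ c))))

∑-permute : ∀ n (π : Permutation′ n) (f : Fin n → ℤ) →
  ∑ n f ≡ ∑[ k < n ] f (π ⟨$⟩ʳ k)
∑-permute n π f =
  trans (∑≡sum f) (trans (sum-permute f π) (sym (∑≡sum (λ k → f (π ⟨$⟩ʳ k)))))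
  where
  -- Σℤ agrees with the library's sum, for which invariance is known.
  open CommutativeMonoidSum ℤP.+-0-commutativeMonoid using (sum; sum-permute)
  ∑≡sum : ∀ {m} (g : Fin m → ℤ) → ∑ m g ≡ sum g
  ∑≡sum {zero}  g = refl
  ∑≡sum {suc m} g = cong (λ t → g zero + t) (∑≡sum (g ∘ suc))

∑-nonneg : ∀ n {f : Fin n → ℤ} → (∀ k → 0ℤ ≤ f k) → 0ℤ ≤ ∑ n f
∑-nonneg zero    f≥0 = +≤+ ℕ.z≤n
∑-nonneg (suc n) f≥0 = ℤP.+-mono-≤ (f≥0 zero) (∑-nonneg n (f≥0 ∘ suc))

∑-nonneg-zero : ∀ n {f : Fin n → ℤ} → (∀ k → 0ℤ ≤ f k) → ∑ n f ≡ 0ℤ → ∀ k → f k ≡ 0ℤ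
∑-nonneg-zero (suc n) {f} f≥0 ∑f≡0 = λ where
    zero    → head≡0
    (suc k) → ∑-nonneg-zero n (f≥0 ∘ suc) tail≡0 k
  where
  open ≡-Reasoning
  -- f 0 ≤ f 0 + ∑ tail = 0, as the tail is nonnegative.
  head≡0 : f zero ≡ 0ℤ
  head≡0 = ℤP.≤-antisym
    (subst₂ _≤_ (ℤP.+-identityʳ (f zero)) ∑f≡0
            (ℤP.+-monoʳ-≤ (f zero) (∑-nonneg n (f≥0 ∘ suc))))
    (f≥0 zero)
  tail≡0 : ∑ n (f ∘ suc) ≡ 0ℤ
  tail≡0 = begin
    ∑ n (f ∘ suc)           ≡⟨ ℤP.+-identityˡ _ ⟨
    0ℤ + ∑ n (f ∘ suc)      ≡⟨ cong (_+ ∑ n (f ∘ suc)) head≡0 ⟨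
    f zero + ∑ n (f ∘ suc)  ≡⟨ ∑f≡0 ⟩
    0ℤ                      ∎

square : ℤ → ℤ
square x = x · x

square-nonneg : ∀ x → 0ℤ ≤ square x
square-nonneg (+ 0)      = +≤+ ℕ.z≤n
square-nonneg +[1+ m ]   = +≤+ ℕ.z≤n
square-nonneg -[1+ m ]   = +≤+ ℕ.z≤n

square-zero : ∀ x → square x ≡ 0ℤ → x ≡ 0ℤ
square-zero x x²≡0 with ℤP.i*j≡0⇒i≡0∨j≡0 x x²≡0
... | inj₁ x≡0 = x≡0
... | inj₂ x≡0 = x≡0

δ-diag : ∀ {n} (i : Fin n) → δ i i ≡ + 1
δ-diag zero    = refl
δ-diag (suc i) = δ-diag i

δ-off : ∀ {n} {i j : Fin n} → i ≢ j → δ i j ≡ 0ℤ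
δ-off {i = zero}  {zero}  i≢j = ⊥-elim (i≢j refl)
δ-off {i = zero}  {suc j} i≢j = refl
δ-off {i = suc i} {zero}  i≢j = refl
δ-off {i = suc i} {suc j} i≢j = δ-off (i≢j ∘ cong suc)

δ-sym : ∀ {n} (i j : Fin n) → δ i j ≡ δ j i
δ-sym zero    zero    = refl
δ-sym zero    (suc j) = refl
δ-sym (suc i) zero    = refl
δ-sym (suc i) (suc j) = δ-sym i j

∑-δ : ∀ n (i : Fin n) (f : Fin n → ℤ) → ∑[ j < n ] (δ i j · f j) ≡ f i
∑-δ (suc n) zero    f = begin
  + 1 · f zero + ∑[ j < n ] (0ℤ · f (suc j))
    ≡⟨ cong₂ _+_ (ℤP.*-identityˡ (f zero)) (∑-cong n (λ j → ℤP.*-zeroˡ (f (suc j)))) ⟩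
  f zero + ∑[ j < n ] 0ℤ                      ≡⟨ cong (λ t → f zero + t) (∑-zero n) ⟩
  f zero + 0ℤ                                 ≡⟨ ℤP.+-identityʳ (f zero) ⟩
  f zero                                      ∎
  where open ≡-Reasoning
∑-δ (suc n) (suc i) f = trans (ℤP.+-identityˡ _) (∑-δ n i (f ∘ suc))

-- Gram matrices.  For a square integer matrix, MMᵀ = cI forces MᵀM = cI,
-- because the two Gram matrices are equally far from cI.

trace : ∀ {n} → Mat n n → ℤ
trace {n} X = ∑[ i < n ] X i i

frobenius² : ∀ {m n} → Mat m n → ℤ
frobenius² {m} {n} X = ∑[ i < m ] ∑[ j < n ] square (X i j)

distance² : ∀ {n} → ℤ → Mat n n → ℤ
distance² {n} c X = ∑[ i < n ] ∑[ j < n ] square (X i j - c · δ i j)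

distance²-row : ∀ {n} c (X : Mat n n) i →
  ∑[ j < n ] square (X i j - c · δ i j) ≡
  ∑[ j < n ] square (X i j) + (- (+ 2 · c)) · X i i + square c
distance²-row {n} c X i = begin
  ∑[ j < n ] square (X i j - c · δ i j)
    ≡⟨ ∑-cong n (λ j → expand (X i j) c (δ i j)) ⟩
  ∑[ j < n ] (square (X i j) + (- (+ 2 · c)) · (δ i j · X i j) + square c · (δ i j · δ i j))
    ≡⟨ ∑-+ n _ _ ⟩
  ∑[ j < n ] (square (X i j) + (- (+ 2 · c)) · (δ i j · X i j))
    + ∑[ j < n ] (square c · (δ i j · δ i j))
    ≡⟨ cong₂ _+_ (∑-+ n _ _) (∑-*ˡ n (square c) _) ⟩
  ∑[ j < n ] square (X i j) + ∑[ j < n ] ((- (+ 2 · c)) · (δ i j · X i j))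
    + square c · ∑[ j < n ] (δ i j · δ i j)
    ≡⟨ cong₂ (λ u v → ∑[ j < n ] square (X i j) + u + square c · v)
             (∑-*ˡ n (- (+ 2 · c)) _) (∑-δ n i (δ i)) ⟩
  ∑[ j < n ] square (X i j) + (- (+ 2 · c)) · ∑[ j < n ] (δ i j · X i j) + square c · δ i i
    ≡⟨ cong₂ (λ u v → ∑[ j < n ] square (X i j) + (- (+ 2 · c)) · u + square c · v)
             (∑-δ n i (X i)) (δ-diag i) ⟩
  ∑[ j < n ] square (X i j) + (- (+ 2 · c)) · X i i + square c · + 1
    ≡⟨ cong (λ t → ∑[ j < n ] square (X i j) + (- (+ 2 · c)) · X i i + t)
            (ℤP.*-identityʳ _) ⟩
  ∑[ j < n ] square (X i j) + (- (+ 2 · c)) · X i i + square c ∎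
  where
  open ≡-Reasoning
  expand : ∀ x c d →
    (x - c · d) · (x - c · d) ≡ x · x + (- (+ 2 · c)) · (d · x) + (c · c) · (d · d)
  expand = solve-∀

distance²-expand : ∀ {n} c (X : Mat n n) →
  distance² c X ≡ frobenius² X + (- (+ 2 · c)) · trace X + + n · square c
distance²-expand {n} c X = begin
  distance² c X
    ≡⟨ ∑-cong n (distance²-row c X) ⟩
  ∑[ i < n ] (∑[ j < n ] square (X i j) + (- (+ 2 · c)) · X i i + square c)
    ≡⟨ ∑-+ n _ _ ⟩
  ∑[ i < n ] (∑[ j < n ] square (X i j) + (- (+ 2 · c)) · X i i) + ∑[ i < n ] square c
    ≡⟨ cong₂ _+_ (∑-+ n _ _) (∑-const n (square c)) ⟩
  frobenius² X + ∑[ i < n ] ((- (+ 2 · c)) · X i i) + + n · square c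
    ≡⟨ cong (λ t → frobenius² X + t + + n · square c) (∑-*ˡ n (- (+ 2 · c)) _) ⟩
  frobenius² X + (- (+ 2 · c)) · trace X + + n · square c ∎
  where open ≡-Reasoning

trace-gram : ∀ {m n} (M : Mat m n) → trace (gramT M) ≡ trace (gram M)
trace-gram {m} {n} M = ∑-swap n m (λ i k → M k i · M k i)

frobenius-gram : ∀ {m n} (M : Mat m n) → frobenius² (gramT M) ≡ frobenius² (gram M)
frobenius-gram {m} {n} M = begin
  ∑[ i < n ] ∑[ j < n ] square (gramT M i j)
    ≡⟨ ∑-cong n (λ i → ∑-cong n (λ j →
         ∑-product m m (λ k → M k i · M k j) (λ l → M l i · M l j))) ⟩
  ∑[ i < n ] ∑[ j < n ] ∑[ k < m ] ∑[ l < m ] ((M k i · M k j) · (M l i · M l j))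
    ≡⟨ ∑-swap-pairs n m _ ⟩
  ∑[ k < m ] ∑[ l < m ] ∑[ i < n ] ∑[ j < n ] ((M k i · M k j) · (M l i · M l j))
    ≡⟨ ∑-cong m (λ k → ∑-cong m (λ l → ∑-cong n (λ i → ∑-cong n (λ j →
         ·-interchange (M k i) (M k j) (M l i) (M l j))))) ⟩
  ∑[ k < m ] ∑[ l < m ] ∑[ i < n ] ∑[ j < n ] ((M k i · M l i) · (M k j · M l j))
    ≡⟨ ∑-cong m (λ k → ∑-cong m (λ l →
         ∑-product n n (λ i → M k i · M l i) (λ j → M k j · M l j))) ⟨
  ∑[ k < m ] ∑[ l < m ] square (gram M k l) ∎
  where open ≡-Reasoning

distance²-gram : ∀ {n} c (M : Mat n n) → distance² c (gramT M) ≡ distance² c (gram M)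
distance²-gram {n} c M = begin
  distance² c (gramT M)
    ≡⟨ distance²-expand c (gramT M) ⟩
  frobenius² (gramT M) + (- (+ 2 · c)) · trace (gramT M) + + n · square c
    ≡⟨ cong₂ (λ u v → u + (- (+ 2 · c)) · v + + n · square c)
             (frobenius-gram M) (trace-gram M) ⟩
  frobenius² (gram M) + (- (+ 2 · c)) · trace (gram M) + + n · square c
    ≡⟨ distance²-expand c (gram M) ⟨
  distance² c (gram M) ∎
  where open ≡-Reasoning

distance²-zero : ∀ {n} c (X : Mat n n) → distance² c X ≡ 0ℤ → ∀ i j → X i j ≡ c · δ i j
distance²-zero {n} c X d≡0 i j =
  ℤP.i-j≡0⇒i≡j _ _ (square-zero _ (∑-nonneg-zero n (λ j → square-nonneg (D i j)) row≡0 j))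
  where
  D : Mat n n
  D i j = X i j - c · δ i j
  row≡0 : ∑[ j < n ] square (D i j) ≡ 0ℤ
  row≡0 = ∑-nonneg-zero n (λ i → ∑-nonneg n (λ j → square-nonneg (D i j))) d≡0 i

columns-orthogonal : ∀ {n} c (M : Mat n n) →
  (∀ i j → gram M i j ≡ c · δ i j) → ∀ i j → gramT M i j ≡ c · δ i j
columns-orthogonal {n} c M rows = distance²-zero c (gramT M) (begin
  distance² c (gramT M)      ≡⟨ distance²-gram c M ⟩
  distance² c (gram M)       ≡⟨ ∑-cong n (λ i → ∑-cong n (λ j → vanish i j)) ⟩
  ∑[ i < n ] ∑[ j < n ] 0ℤ   ≡⟨ ∑-cong n (λ _ → ∑-zero n) ⟩
  ∑[ i < n ] 0ℤ              ≡⟨ ∑-zero n ⟩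
  0ℤ                         ∎)
  where
  open ≡-Reasoning
  vanish : ∀ i j → square (gram M i j - c · δ i j) ≡ 0ℤ
  vanish i j = trans (cong (λ t → square (t - c · δ i j)) (rows i j))
                     (cong square (ℤP.+-inverseʳ (c · δ i j)))

IsSign : ℤ → Set
IsSign x = (x ≡ + 1) ⊎ (x ≡ - + 1)

IsBit : ℤ → Set
IsBit x = (x ≡ 0ℤ) ⊎ (x ≡ + 1)

sign-· : ∀ {x y} → IsSign x → IsSign y → IsSign (x · y)
sign-· (inj₁ refl) (inj₁ refl) = inj₁ refl
sign-· (inj₁ refl) (inj₂ refl) = inj₂ refl
sign-· (inj₂ refl) (inj₁ refl) = inj₂ refl
sign-· (inj₂ refl) (inj₂ refl) = inj₁ refl

sign : Bool → ℤ
sign true  = + 1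
sign false = - + 1

indicator : Bool → ℤ
indicator true  = + 1
indicator false = 0ℤ

indicator-bit : ∀ b → IsBit (indicator b)
indicator-bit true  = inj₂ refl
indicator-bit false = inj₁ refl

sign-indicator : ∀ b → sign b ≡ + 2 · indicator b - + 1
sign-indicator true  = refl
sign-indicator false = refl

isOne : ℤ → Bool
isOne (+ 1) = true
isOne _     = false

sign-isOne : ∀ {x} → IsBit x → sign (isOne x) ≡ + 2 · x - + 1
sign-isOne (inj₁ refl) = refl
sign-isOne (inj₂ refl) = refl

_⇔ᵇ_ : Bool → Bool → Bool
a ⇔ᵇ b = not (a xor b)

sign-⇔ᵇ : ∀ a b → sign (a ⇔ᵇ b) ≡ sign a · sign b
sign-⇔ᵇ true  true  = refl
sign-⇔ᵇ true  false = refl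
sign-⇔ᵇ false true  = refl
sign-⇔ᵇ false false = refl

∑-marked : ∀ n (p : Fin n → Bool) (x : Fin n → ℤ) →
  + 2 · ∑[ k < n ] (indicator (p k) · x k) ≡ ∑[ k < n ] (sign (p k) · x k) + ∑ n x
∑-marked n p x = begin
  + 2 · ∑[ k < n ] (indicator (p k) · x k)     ≡⟨ ∑-*ˡ n (+ 2) _ ⟨
  ∑[ k < n ] (+ 2 · (indicator (p k) · x k))   ≡⟨ ∑-cong n (λ k → double-indicator (p k) (x k)) ⟩
  ∑[ k < n ] (sign (p k) · x k + x k)          ≡⟨ ∑-+ n _ x ⟩
  ∑[ k < n ] (sign (p k) · x k) + ∑ n x        ∎
  where
  open ≡-Reasoning
  double-indicator : ∀ b y → + 2 · (indicator b · y) ≡ sign b · y + y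
  double-indicator true  = solve-∀
  double-indicator false = solve-∀

record FrontPermutation (n : ℕ) (p : Fin n → Bool) : Set where
  field
    size   : ℕ
    size≤n : size ℕ.≤ n
    perm   : Permutation′ n
    front  : ∀ k → p k ≡ (toℕ (perm ⟨$⟩ˡ k) ℕ.<ᵇ size)

punchIn-<ᵇ : ∀ {m} (i : Fin (suc m)) (j : Fin m) →
  (toℕ (punchIn i j) ℕ.<ᵇ toℕ i) ≡ (toℕ j ℕ.<ᵇ toℕ i)
punchIn-<ᵇ zero    j       = refl
punchIn-<ᵇ (suc i) zero    = refl
punchIn-<ᵇ (suc i) (suc j) = punchIn-<ᵇ i j

n<ᵇn : ∀ n → (n ℕ.<ᵇ n) ≡ false
n<ᵇn zero    = refl
n<ᵇn (suc n) = n<ᵇn n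

-- Every marking can be moved to the front.  By recursion on n: a marked
-- position 0 stays in front (lift₀); an unmarked one is sent to position ℓ
-- just behind the marked block (insert).
frontPermutation : ∀ n (p : Fin n → Bool) → FrontPermutation n p
frontPermutation zero    p =
  record { size = 0 ; size≤n = ℕ.z≤n ; perm = Perm.id ; front = λ () }
frontPermutation (suc m) p with frontPermutation m (p ∘ suc) | p zero in p₀
... | record { size = ℓ ; size≤n = ℓ≤m ; perm = π ; front = front } | true =
  record { size = suc ℓ ; size≤n = ℕ.s≤s ℓ≤m
         ; perm = Perm.lift₀ π ; front = front′ }
  where
  front′ : ∀ k → p k ≡ (toℕ (Perm.lift₀ π ⟨$⟩ˡ k) ℕ.<ᵇ suc ℓ)
  front′ zero    = p₀
  front′ (suc k) = front k
... | record { size = ℓ ; size≤n = ℓ≤m ; perm = π ; front = front } | false =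
  record { size = ℓ ; size≤n = ℕP.m≤n⇒m≤1+n ℓ≤m
         ; perm = Perm.insert slot zero π ; front = front′ }
  where
  slot : Fin (suc m)
  slot = Fin.fromℕ< (ℕ.s≤s ℓ≤m)
  toℕ-slot : toℕ slot ≡ ℓ
  toℕ-slot = FinP.toℕ-fromℕ< (ℕ.s≤s ℓ≤m)
  front′ : ∀ k → p k ≡ (toℕ (Perm.insert slot zero π ⟨$⟩ˡ k) ℕ.<ᵇ ℓ)
  front′ zero    = trans p₀ (trans (sym (n<ᵇn ℓ)) (cong (ℕ._<ᵇ ℓ) (sym toℕ-slot)))
  -- Punching in at the slot does not move a position across ℓ.
  front′ (suc k) = trans (front k)
    (subst (λ L → (toℕ j ℕ.<ᵇ L) ≡ (toℕ (punchIn slot j) ℕ.<ᵇ L))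
           toℕ-slot (sym (punchIn-<ᵇ slot j)))
    where j = π ⟨$⟩ˡ k

∑-initial : ∀ n ℓ (ℓ≤n : ℓ ℕ.≤ n) (g : Fin n → ℤ) →
  ∑[ r < n ] (indicator (toℕ r ℕ.<ᵇ ℓ) · g r) ≡ ∑[ r < ℓ ] g (inject≤ r ℓ≤n)
∑-initial n       zero    ℓ≤n        g = trans (∑-cong n (λ r → ℤP.*-zeroˡ (g r))) (∑-zero n)
∑-initial (suc n) (suc ℓ) (ℕ.s≤s ℓ≤n) g =
  cong₂ _+_ (ℤP.*-identityˡ (g zero)) (∑-initial n ℓ ℓ≤n (g ∘ suc))

∑-front : ∀ {n p} (F : FrontPermutation n p) (f : Fin n → ℤ) →
  let open FrontPermutation F in
  ∑[ r < size ] f (perm ⟨$⟩ʳ inject≤ r size≤n) ≡ ∑[ k < n ] (indicator (p k) · f k)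
∑-front {n} {p} F f = begin
  ∑[ r < size ] f (perm ⟨$⟩ʳ inject≤ r size≤n)
    ≡⟨ ∑-initial n size size≤n (λ r → f (perm ⟨$⟩ʳ r)) ⟨
  ∑[ r < n ] (indicator (toℕ r ℕ.<ᵇ size) · f (perm ⟨$⟩ʳ r))
    ≡⟨ ∑-cong n (λ r → cong (λ b → indicator b · f (perm ⟨$⟩ʳ r)) (marked r)) ⟨
  ∑[ r < n ] (indicator (p (perm ⟨$⟩ʳ r)) · f (perm ⟨$⟩ʳ r))
    ≡⟨ ∑-permute n perm (λ k → indicator (p k) · f k) ⟨
  ∑[ k < n ] (indicator (p k) · f k) ∎
  where
  open ≡-Reasoning
  open FrontPermutation F
  marked : ∀ r → p (perm ⟨$⟩ʳ r) ≡ (toℕ r ℕ.<ᵇ size)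
  marked r = trans (front (perm ⟨$⟩ʳ r)) (cong (λ k → toℕ k ℕ.<ᵇ size) (Perm.inverseˡ perm))

front-size : ∀ {n p} (F : FrontPermutation n p) →
  + (2 ℕ.* FrontPermutation.size F) ≡ ∑[ k < n ] sign (p k) + + n
front-size {n} {p} F = begin
  + (2 ℕ.* size)                                    ≡⟨ ℤP.pos-* 2 size ⟩
  + 2 · + size                                      ≡⟨ cong (+ 2 ·_) (ones size) ⟨
  + 2 · ∑[ r < size ] (+ 1)                         ≡⟨ cong (+ 2 ·_) (∑-front F (λ _ → + 1)) ⟩
  + 2 · ∑[ k < n ] (indicator (p k) · + 1)          ≡⟨ ∑-marked n p (λ _ → + 1) ⟩
  ∑[ k < n ] (sign (p k) · + 1) + ∑[ k < n ] (+ 1)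
    ≡⟨ cong₂ _+_ (∑-cong n (λ k → ℤP.*-identityʳ (sign (p k)))) (ones n) ⟩
  ∑[ k < n ] sign (p k) + + n                       ∎
  where
  open ≡-Reasoning
  open FrontPermutation F
  ones : ∀ m → ∑[ k < m ] (+ 1) ≡ + m
  ones m = trans (∑-const m (+ 1)) (ℤP.*-identityʳ (+ m))

weightedGram : ∀ {m n} → (Fin m → ℤ) → Mat m n → Fin n → Fin n → ℤ
weightedGram {m} w M i j = ∑[ k < m ] (w k · (M k i · M k j))

frontRows : ∀ {n p} (F : FrontPermutation n p) → Mat n n → Mat (FrontPermutation.size F) n
frontRows F H r c = H (perm ⟨$⟩ʳ inject≤ r size≤n) c
  where open FrontPermutation F

front-gram : ∀ {n p} (F : FrontPermutation n p) (H : Mat n n) i j →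
  + 2 · gramT (frontRows F H) i j ≡ weightedGram (sign ∘ p) H i j + gramT H i j
front-gram {n} {p} F H i j =
  trans (cong (+ 2 ·_) (∑-front F (λ k → H k i · H k j))) (∑-marked n p (λ k → H k i · H k j))

excess-from-size : ∀ {n p} (F : FrontPermutation n p) s →
  2 ℕ.* FrontPermutation.size F ≡ n ℕ.+ s → ∑[ k < n ] sign (p k) ≡ + s
excess-from-size {n} {p} F s 2ℓ≡n+s = +-cancelʳ (+ n) _ (+ s) (begin
  ∑[ k < n ] sign (p k) + + n     ≡⟨ front-size F ⟨
  + (2 ℕ.* size)                  ≡⟨ cong +_ (trans 2ℓ≡n+s (ℕP.+-comm n s)) ⟩
  + (s ℕ.+ n)                     ≡⟨ ℤP.pos-+ s n ⟩
  + s + + n                       ∎)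
  where
  open ≡-Reasoning
  open FrontPermutation F

size-from-excess : ∀ {n p} (F : FrontPermutation n p) s →
  ∑[ k < n ] sign (p k) ≡ + s → 2 ℕ.* FrontPermutation.size F ≡ n ℕ.+ s
size-from-excess {n} {p} F s excess = ℤP.+-injective (begin
  + (2 ℕ.* size)                  ≡⟨ front-size F ⟩
  ∑[ k < n ] sign (p k) + + n     ≡⟨ cong (_+ + n) excess ⟩
  + s + + n                       ≡⟨ ℤP.pos-+ s n ⟨
  + (s ℕ.+ n)                     ≡⟨ cong +_ (ℕP.+-comm s n) ⟩
  + (n ℕ.+ s)                     ∎)
  where
  open ≡-Reasoning
  open FrontPermutation F

splitEntry : (ℓ s : ℕ) (a d : ℤ) → ℤ
splitEntry ℓ s a d = + (2 ℕ.* ℓ) · d + + s · a + (- (+ s)) · (+ 1 - a - d)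

splitEntry-signed : ∀ {ℓ n s} → 2 ℕ.* ℓ ≡ n ℕ.+ s → ∀ a d →
  splitEntry ℓ s a d ≡ + n · d + + s · (+ 2 · (a + d) - + 1)
splitEntry-signed {ℓ} {n} {s} 2ℓ≡n+s a d = begin
  splitEntry ℓ s a d
    ≡⟨ cong (λ L → L · d + + s · a + (- (+ s)) · (+ 1 - a - d))
            (trans (cong +_ 2ℓ≡n+s) (ℤP.pos-+ n s)) ⟩
  (+ n + + s) · d + + s · a + (- (+ s)) · (+ 1 - a - d)
    ≡⟨ regroup (+ n) (+ s) a d ⟩
  + n · d + + s · (+ 2 · (a + d) - + 1) ∎
  where
  open ≡-Reasoning
  regroup : ∀ n s a d →
    (n + s) · d + s · a + (- s) · (+ 1 - a - d) ≡ n · d + s · (+ 2 · (a + d) - + 1)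
  regroup = solve-∀

module _ {n p} (F : FrontPermutation n p) (H : Mat n n) {s : ℕ}
         (2ℓ≡n+s : 2 ℕ.* FrontPermutation.size F ≡ n ℕ.+ s)
         (columns : ∀ i j → gramT H i j ≡ + n · δ i j) where

  open FrontPermutation F
  open ≡-Reasoning

  splitting→signed : ∀ {i j} a →
    + 2 · gramT (frontRows F H) i j ≡ splitEntry size s a (δ i j) →
    weightedGram (sign ∘ p) H i j ≡ + s · (+ 2 · (a + δ i j) - + 1)
  splitting→signed {i} {j} a split = begin
    weightedGram (sign ∘ p) H i j
      ≡⟨ cancel _ (gramT H i j) ⟨
    weightedGram (sign ∘ p) H i j + gramT H i j - gramT H i j
      ≡⟨ cong₂ _-_ (sym (front-gram F H i j)) (columns i j) ⟩
    + 2 · gramT (frontRows F H) i j - + n · δ i j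
      ≡⟨ cong (_- + n · δ i j) split ⟩
    splitEntry size s a (δ i j) - + n · δ i j
      ≡⟨ cong (_- + n · δ i j) (splitEntry-signed {size} {n} {s} 2ℓ≡n+s a (δ i j)) ⟩
    + n · δ i j + + s · (+ 2 · (a + δ i j) - + 1) - + n · δ i j
      ≡⟨ cancelˡ (+ n · δ i j) _ ⟩
    + s · (+ 2 · (a + δ i j) - + 1) ∎
    where
    cancel : ∀ x y → x + y - y ≡ x
    cancel = solve-∀
    cancelˡ : ∀ y x → y + x - y ≡ x
    cancelˡ = solve-∀

  signed→splitting : ∀ {i j} a →
    weightedGram (sign ∘ p) H i j ≡ + s · (+ 2 · (a + δ i j) - + 1) →
    + 2 · gramT (frontRows F H) i j ≡ splitEntry size s a (δ i j)
  signed→splitting {i} {j} a signed = begin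
    + 2 · gramT (frontRows F H) i j
      ≡⟨ front-gram F H i j ⟩
    weightedGram (sign ∘ p) H i j + gramT H i j
      ≡⟨ cong₂ _+_ signed (columns i j) ⟩
    + s · (+ 2 · (a + δ i j) - + 1) + + n · δ i j
      ≡⟨ ℤP.+-comm _ (+ n · δ i j) ⟩
    + n · δ i j + + s · (+ 2 · (a + δ i j) - + 1)
      ≡⟨ splitEntry-signed {size} {n} {s} 2ℓ≡n+s a (δ i j) ⟨
    splitEntry size s a (δ i j) ∎

-- The signed form of a balanced splitting of order n = s²: rows marked by
-- `upper` (Y = diag(sign ∘ upper)) and a reflexive symmetric relation `linked`
-- (S = sign ∘ linked, i.e. S = 2(A+I) − J) with HᵀYH = sS and trace Y = s.
record SignedSplitting (n : ℕ) : Set where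
  field
    s             : ℕ
    s²≡n          : s * s ≡ n
    H             : Mat n n
    hadamard      : IsHadamard n H
    upper         : Fin n → Bool
    linked        : Fin n → Fin n → Bool
    linked-sym    : ∀ i j → linked i j ≡ linked j i
    linked-refl   : ∀ i → linked i i ≡ true
    upper-excess  : ∑[ k < n ] sign (upper k) ≡ + s
    signed-gram   : ∀ i j → weightedGram (sign ∘ upper) H i j ≡ + s · sign (linked i j)

adjacency-reflexive-bit : ∀ {n A} → IsAdjacency n A → ∀ i j → IsBit (A i j + δ i j)
adjacency-reflexive-bit {A = A} (bit , _ , diag) i j with i Fin.≟ j
... | yes refl = inj₂ (cong₂ _+_ (diag i) (δ-diag i))
... | no  i≢j  rewrite δ-off i≢j | ℤP.+-identityʳ (A i j) = bit i j

toSigned : ∀ {n} → HasBSHadamardSqrtParams n → SignedSplitting n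
toSigned {n} (s , s²≡n , ℓ , 2ℓ≡n+s , H , hadamard@(_ , rows) ,
              ℓ≤n , π , A , adjacency@(_ , A-sym , A-diag) , split) = record
  { s = s ; s²≡n = s²≡n ; H = H ; hadamard = hadamard
  ; upper = upper ; linked = linked
  ; linked-sym = λ i j → cong isOne (cong₂ _+_ (A-sym i j) (δ-sym i j))
  ; linked-refl = λ i → cong isOne (cong₂ _+_ (A-diag i) (δ-diag i))
  ; upper-excess = excess-from-size F s 2ℓ≡n+s
  ; signed-gram = λ i j → trans
      (splitting→signed F H 2ℓ≡n+s (columns-orthogonal (+ n) H rows) (A i j) (split i j))
      (cong (+ s ·_) (sym (sign-isOne (adjacency-reflexive-bit adjacency i j))))
  }
  where
  upper : Fin n → Bool
  upper k = toℕ (π ⟨$⟩ˡ k) ℕ.<ᵇ ℓ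
  F : FrontPermutation n upper
  F = record { size = ℓ ; size≤n = ℓ≤n ; perm = π ; front = λ _ → refl }
  linked : Fin n → Fin n → Bool
  linked i j = isOne (A i j + δ i j)

fromSigned : ∀ {n} → SignedSplitting n → HasBSHadamardSqrtParams n
fromSigned {n} S =
  s , s²≡n , ℓ , 2ℓ≡n+s , H , hadamard , size≤n , perm , A , adjacency , split
  where
  open SignedSplitting S
  F : FrontPermutation n upper
  F = frontPermutation n upper
  open FrontPermutation F renaming (size to ℓ)
  2ℓ≡n+s : 2 ℕ.* ℓ ≡ n ℕ.+ s
  2ℓ≡n+s = size-from-excess F s upper-excess
  A : Mat n n
  A i j = indicator (linked i j) - δ i j
  A-diag : ∀ i → A i i ≡ 0ℤ
  A-diag i = cong₂ _-_ (cong indicator (linked-refl i)) (δ-diag i)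
  A-bit : ∀ i j → IsBit (A i j)
  A-bit i j with i Fin.≟ j
  ... | yes refl = inj₁ (A-diag i)
  ... | no  i≢j  rewrite δ-off i≢j | ℤP.+-identityʳ (indicator (linked i j)) =
    indicator-bit (linked i j)
  adjacency : IsAdjacency n A
  adjacency =
    A-bit , (λ i j → cong₂ _-_ (cong indicator (linked-sym i j)) (δ-sym i j)) , A-diag
  sign-linked : ∀ i j → sign (linked i j) ≡ + 2 · (A i j + δ i j) - + 1
  sign-linked i j = trans (sign-indicator (linked i j))
    (cong (λ e → + 2 · e - + 1) (restore (indicator (linked i j)) (δ i j)))
    where
    restore : ∀ e d → e ≡ (e - d) + d
    restore = solve-∀
  split : ∀ i j → + 2 · gramT (frontRows F H) i j ≡ splitEntry ℓ s (A i j) (δ i j)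
  split i j = signed→splitting F H 2ℓ≡n+s (columns-orthogonal (+ n) H (proj₂ hadamard)) (A i j)
    (trans (signed-gram i j) (cong (+ s ·_) (sign-linked i j)))

module Kronecker (n₁ n₂ : ℕ) where

  outer : Fin (n₁ * n₂) → Fin n₁
  outer c = proj₁ (remQuot {n₁} n₂ c)

  inner : Fin (n₁ * n₂) → Fin n₂
  inner c = proj₂ (remQuot {n₁} n₂ c)

  ∑-pairs : ∀ (f : Fin n₁ → Fin n₂ → ℤ) →
    ∑[ c < n₁ * n₂ ] f (outer c) (inner c) ≡ ∑[ a < n₁ ] ∑[ b < n₂ ] f a b
  ∑-pairs f = trans (∑-combine n₁ n₂ _) (∑-cong n₁ (λ a → ∑-cong n₂ (λ b →
    cong (λ ab → f (proj₁ ab) (proj₂ ab)) (FinP.remQuot-combine a b))))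

  ∑-⊗ : ∀ (f : Fin n₁ → ℤ) (g : Fin n₂ → ℤ) →
    ∑[ c < n₁ * n₂ ] (f (outer c) · g (inner c)) ≡ ∑ n₁ f · ∑ n₂ g
  ∑-⊗ f g = trans (∑-pairs (λ a b → f a · g b)) (sym (∑-product n₁ n₂ f g))

  δ-⊗ : ∀ c d → δ c d ≡ δ (outer c) (outer d) · δ (inner c) (inner d)
  δ-⊗ c d with c Fin.≟ d
  ... | yes refl rewrite δ-diag (outer c) | δ-diag (inner c) = δ-diag c
  ... | no  c≢d with outer c Fin.≟ outer d | inner c Fin.≟ inner d
  ...   | yes outer≡ | yes inner≡ = ⊥-elim (c≢d (begin
          c                                  ≡⟨ FinP.combine-remQuot {n₁} n₂ c ⟨
          combine (outer c) (inner c)        ≡⟨ cong₂ combine outer≡ inner≡ ⟩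
          combine (outer d) (inner d)        ≡⟨ FinP.combine-remQuot {n₁} n₂ d ⟩
          d                                  ∎))
    where open ≡-Reasoning
  ...   | no  outer≢ | _          rewrite δ-off c≢d | δ-off outer≢ = refl
  ...   | yes _      | no  inner≢ rewrite δ-off c≢d | δ-off inner≢ =
          sym (ℤP.*-zeroʳ (δ (outer c) (outer d)))

  infixl 7 _⊗_ _⊗ᵥ_ _⊗ᵇ_

  _⊗_ : Mat n₁ n₁ → Mat n₂ n₂ → Mat (n₁ * n₂) (n₁ * n₂)
  (M₁ ⊗ M₂) c d = M₁ (outer c) (outer d) · M₂ (inner c) (inner d)

  _⊗ᵥ_ : (Fin n₁ → ℤ) → (Fin n₂ → ℤ) → Fin (n₁ * n₂) → ℤ
  (w₁ ⊗ᵥ w₂) c = w₁ (outer c) · w₂ (inner c)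

  _⊗ᵇ_ : (Fin n₁ → Bool) → (Fin n₂ → Bool) → Fin (n₁ * n₂) → Bool
  (u₁ ⊗ᵇ u₂) c = u₁ (outer c) ⇔ᵇ u₂ (inner c)

  sign-⊗ᵇ : ∀ u₁ u₂ c → sign ((u₁ ⊗ᵇ u₂) c) ≡ ((sign ∘ u₁) ⊗ᵥ (sign ∘ u₂)) c
  sign-⊗ᵇ u₁ u₂ c = sign-⇔ᵇ (u₁ (outer c)) (u₂ (inner c))

  gram-⊗ : ∀ M₁ M₂ c d →
    gram (M₁ ⊗ M₂) c d ≡ gram M₁ (outer c) (outer d) · gram M₂ (inner c) (inner d)
  gram-⊗ M₁ M₂ c d = trans
    (∑-cong (n₁ * n₂) (λ e → ·-interchange (M₁ (outer c) (outer e)) (M₂ (inner c) (inner e))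
                                          (M₁ (outer d) (outer e)) (M₂ (inner d) (inner e))))
    (∑-⊗ (λ x → M₁ (outer c) x · M₁ (outer d) x) (λ y → M₂ (inner c) y · M₂ (inner d) y))

  weightedGram-⊗ : ∀ w₁ w₂ M₁ M₂ c d →
    weightedGram (w₁ ⊗ᵥ w₂) (M₁ ⊗ M₂) c d
      ≡ weightedGram w₁ M₁ (outer c) (outer d) · weightedGram w₂ M₂ (inner c) (inner d)
  weightedGram-⊗ w₁ w₂ M₁ M₂ c d = trans
    (∑-cong (n₁ * n₂) (λ e → regroup (w₁ (outer e)) (w₂ (inner e))
       (M₁ (outer e) (outer c)) (M₂ (inner e) (inner c))
       (M₁ (outer e) (outer d)) (M₂ (inner e) (inner d))))
    (∑-⊗ (λ x → w₁ x · (M₁ x (outer c) · M₁ x (outer d)))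
         (λ y → w₂ y · (M₂ y (inner c) · M₂ y (inner d))))
    where
    regroup : ∀ v₁ v₂ a₁ a₂ b₁ b₂ →
      (v₁ · v₂) · ((a₁ · a₂) · (b₁ · b₂)) ≡ (v₁ · (a₁ · b₁)) · (v₂ · (a₂ · b₂))
    regroup = solve-∀

  scaled-· : ∀ a b x y → (+ a · x) · (+ b · y) ≡ + (a * b) · (x · y)
  scaled-· a b x y =
    trans (·-interchange (+ a) x (+ b) y) (cong (_· (x · y)) (sym (ℤP.pos-* a b)))

  hadamard-⊗ : ∀ {H₁ H₂} →
    IsHadamard n₁ H₁ → IsHadamard n₂ H₂ → IsHadamard (n₁ * n₂) (H₁ ⊗ H₂)
  hadamard-⊗ {H₁} {H₂} (signs₁ , rows₁) (signs₂ , rows₂) = signs , rows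
    where
    signs : ∀ c d → IsSign ((H₁ ⊗ H₂) c d)
    signs c d = sign-· (signs₁ (outer c) (outer d)) (signs₂ (inner c) (inner d))
    rows : ∀ c d → gram (H₁ ⊗ H₂) c d ≡ + (n₁ * n₂) · δ c d
    rows c d = begin
      gram (H₁ ⊗ H₂) c d
        ≡⟨ gram-⊗ H₁ H₂ c d ⟩
      gram H₁ (outer c) (outer d) · gram H₂ (inner c) (inner d)
        ≡⟨ cong₂ _·_ (rows₁ (outer c) (outer d)) (rows₂ (inner c) (inner d)) ⟩
      (+ n₁ · δ (outer c) (outer d)) · (+ n₂ · δ (inner c) (inner d))
        ≡⟨ scaled-· n₁ n₂ _ _ ⟩
      + (n₁ * n₂) · (δ (outer c) (outer d) · δ (inner c) (inner d))
        ≡⟨ cong (+ (n₁ * n₂) ·_) (δ-⊗ c d) ⟨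
      + (n₁ * n₂) · δ c d ∎
      where open ≡-Reasoning

  excess-⊗ : ∀ u₁ u₂ →
    ∑[ c < n₁ * n₂ ] sign ((u₁ ⊗ᵇ u₂) c) ≡ ∑[ a < n₁ ] sign (u₁ a) · ∑[ b < n₂ ] sign (u₂ b)
  excess-⊗ u₁ u₂ = trans (∑-cong (n₁ * n₂) (sign-⊗ᵇ u₁ u₂)) (∑-⊗ (sign ∘ u₁) (sign ∘ u₂))

  signedGram-⊗ : ∀ u₁ u₂ H₁ H₂ c d →
    weightedGram (sign ∘ (u₁ ⊗ᵇ u₂)) (H₁ ⊗ H₂) c d
      ≡ weightedGram (sign ∘ u₁) H₁ (outer c) (outer d)
        · weightedGram (sign ∘ u₂) H₂ (inner c) (inner d)
  signedGram-⊗ u₁ u₂ H₁ H₂ c d = trans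
    (∑-cong (n₁ * n₂) (λ e → cong (_· ((H₁ ⊗ H₂) e c · (H₁ ⊗ H₂) e d)) (sign-⊗ᵇ u₁ u₂ e)))
    (weightedGram-⊗ (sign ∘ u₁) (sign ∘ u₂) H₁ H₂ c d)

  signed-⊗ : SignedSplitting n₁ → SignedSplitting n₂ → SignedSplitting (n₁ * n₂)
  signed-⊗ S₁ S₂ = record
    { s = S₁.s * S₂.s
    ; s²≡n = trans (ℕP.[m*n]*[o*p]≡[m*o]*[n*p] S₁.s S₂.s S₁.s S₂.s)
                   (cong₂ _*_ S₁.s²≡n S₂.s²≡n)
    ; H = S₁.H ⊗ S₂.H
    ; hadamard = hadamard-⊗ S₁.hadamard S₂.hadamard
    ; upper = S₁.upper ⊗ᵇ S₂.upper
    ; linked = linked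
    ; linked-sym = λ c d →
        cong₂ _⇔ᵇ_ (S₁.linked-sym (outer c) (outer d)) (S₂.linked-sym (inner c) (inner d))
    ; linked-refl = λ c → cong₂ _⇔ᵇ_ (S₁.linked-refl (outer c)) (S₂.linked-refl (inner c))
    ; upper-excess = trans (excess-⊗ S₁.upper S₂.upper)
        (trans (cong₂ _·_ S₁.upper-excess S₂.upper-excess) (sym (ℤP.pos-* S₁.s S₂.s)))
    ; signed-gram = signed-gram
    }
    where
    module S₁ = SignedSplitting S₁
    module S₂ = SignedSplitting S₂
    linked : Fin (n₁ * n₂) → Fin (n₁ * n₂) → Bool
    linked c d = S₁.linked (outer c) (outer d) ⇔ᵇ S₂.linked (inner c) (inner d)
    signed-gram : ∀ c d →
      weightedGram (sign ∘ (S₁.upper ⊗ᵇ S₂.upper)) (S₁.H ⊗ S₂.H) c d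
        ≡ + (S₁.s * S₂.s) · sign (linked c d)
    signed-gram c d = begin
      weightedGram (sign ∘ (S₁.upper ⊗ᵇ S₂.upper)) (S₁.H ⊗ S₂.H) c d
        ≡⟨ signedGram-⊗ S₁.upper S₂.upper S₁.H S₂.H c d ⟩
      weightedGram (sign ∘ S₁.upper) S₁.H (outer c) (outer d)
        · weightedGram (sign ∘ S₂.upper) S₂.H (inner c) (inner d)
        ≡⟨ cong₂ _·_ (S₁.signed-gram (outer c) (outer d)) (S₂.signed-gram (inner c) (inner d)) ⟩
      (+ S₁.s · sign l₁) · (+ S₂.s · sign l₂)
        ≡⟨ scaled-· S₁.s S₂.s (sign l₁) (sign l₂) ⟩
      + (S₁.s * S₂.s) · (sign l₁ · sign l₂)
        ≡⟨ cong (+ (S₁.s * S₂.s) ·_) (sign-⇔ᵇ l₁ l₂) ⟨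
      + (S₁.s * S₂.s) · sign (linked c d) ∎
      where
      open ≡-Reasoning
      l₁ = S₁.linked (outer c) (outer d)
      l₂ = S₂.linked (inner c) (inner d)

lemma3p6 : (n₁ n₂ : ℕ) → 0 < n₁ → 0 < n₂ →
    HasBSHadamardSqrtParams n₁ → HasBSHadamardSqrtParams n₂ →
    HasBSHadamardSqrtParams (n₁ * n₂)
lemma3p6 n₁ n₂ _ _ split₁ split₂ =
  fromSigned (signed-⊗ (toSigned split₁) (toSigned split₂))
  where open Kronecker n₁ n₂
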